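{- Let $G$ be a connected claw-free subcubic graph that is not isomorphic to any of the triangular prism, $K_4$, or $K_4^{\Delta}$. If $G$ has a vertex of degree $1$, then $\chi'_s(G)\le 7$.
   Context: A graph is claw-free if it has no induced $K_{1,3}$, and subcubic if its maximum degree is at most $3$. The triangular prism is the graph consisting of two disjoint triangles $a_1a_2a_3$, $b_1b_2b_3$ and edges $a_ib_i$, $i=1,2,3$. $K_4^{\Delta}$ is the graph obtained from $K_4$ by replacing each vertex with a $3$-cycle (each vertex $v$ of $K_4$ becomes a triangle, and each edge $uv$ of $K_4$ becomes an edge joining a vertex of the triangle of $u$ to a vertex of the triangle of $v$, so that the result is cubic). $\chi'_s(G)$ is the strong chromatic index: the least $k$ such that the edges can be colored with $k$ colors so that any two edges that share a vertex, or are both adjacent to a common edge, receive different colors. -}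

module Defs where

open import Data.Nat using (ℕ; _≤_)
open import Data.Bool using (Bool; true; false; if_then_else_; _∧_; _∨_; not)
open import Data.Fin using (Fin; remQuot; punchIn)
open import Data.Fin.Properties using (_≟_)
open import Data.List using (map; allFin)
open import Data.Nat.ListAction using (sum)
open import Data.Product using (Σ; _×_; _,_; proj₁; proj₂; ∃)
open import Data.Sum using (_⊎_)
open import Relation.Nullary using (¬_)
open import Relation.Nullary.Decidable using (⌊_⌋)
open import Relation.Binary.PropositionalEquality using (_≡_)
open import Function.Bundles using (_↔_; Inverse)

record Graph : Set where
  field
    n     : ℕ
    adj   : Fin n → Fin n → Bool
    sym   : ∀ u v → adj u v ≡ adj v u
    irrefl : ∀ v → adj v v ≡ false
open Graph public

Adj : (G : Graph) → Fin (n G) → Fin (n G) → Set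
Adj G u v = adj G u v ≡ true

degree : (G : Graph) → Fin (n G) → ℕ
degree G v = sum (map (λ w → if adj G v w then 1 else 0) (allFin (n G)))

Subcubic : Graph → Set
Subcubic G = ∀ v → degree G v ≤ 3

ClawFree : Graph → Set
ClawFree G = ¬ (Σ (Fin (n G)) λ v → Σ (Fin (n G)) λ a → Σ (Fin (n G)) λ b → Σ (Fin (n G)) λ c →
  Adj G v a × Adj G v b × Adj G v c ×
  ¬ (a ≡ b) × ¬ (a ≡ c) × ¬ (b ≡ c) ×
  ¬ Adj G a b × ¬ Adj G a c × ¬ Adj G b c)

data Reach (G : Graph) : Fin (n G) → Fin (n G) → Set where
  here : ∀ {u} → Reach G u u
  step : ∀ {u w v} → Adj G u w → Reach G w v → Reach G u v

Connected : Graph → Set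
Connected G = ∀ u v → Reach G u v

-- strong edge colouring with k colours: a colour for every edge, independent of
-- orientation, such that two distinct edges uv, xy receive different colours
-- whenever an endpoint of one equals or is adjacent to an endpoint of the other
-- (i.e. they share a vertex or are both adjacent to a common edge).
SameEdge : {m : ℕ} → Fin m → Fin m → Fin m → Fin m → Set
SameEdge u v x y = (u ≡ x × v ≡ y) ⊎ (u ≡ y × v ≡ x)

Close : (G : Graph) → Fin (n G) → Fin (n G) → Set
Close G a b = a ≡ b ⊎ Adj G a b

Within2 : (G : Graph) → (u v x y : Fin (n G)) → Set
Within2 G u v x y = Close G u x ⊎ Close G u y ⊎ Close G v x ⊎ Close G v y

record StrongEdgeColouring (G : Graph) (k : ℕ) : Set where
  field
    col    : (u v : Fin (n G)) → Adj G u v → Fin k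
    colSym : ∀ u v (p : Adj G u v) (q : Adj G v u) → col u v p ≡ col v u q
    strong : ∀ u v x y (p : Adj G u v) (q : Adj G x y) →
             ¬ SameEdge u v x y → Within2 G u v x y → ¬ (col u v p ≡ col x y q)

StrongChromaticIndex≤ : Graph → ℕ → Set
StrongChromaticIndex≤ G k = StrongEdgeColouring G k

private
  neq : {m : ℕ} → Fin m → Fin m → Bool
  neq i j = not ⌊ i ≟ j ⌋
  eq : {m : ℕ} → Fin m → Fin m → Bool
  eq i j = ⌊ i ≟ j ⌋

K4adj : Fin 4 → Fin 4 → Bool
K4adj = neq

-- triangular prism: vertex k ↦ (s , i) ∈ Fin 2 × Fin 3 (triangle s, position i);
-- (s,i) ~ (t,j) iff (s = t and i ≠ j) or (s ≠ t and i = j)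
prismAdj : Fin 6 → Fin 6 → Bool
prismAdj x y with remQuot {2} 3 x | remQuot {2} 3 y
... | (s , i) | (t , j) = (eq s t ∧ neq i j) ∨ (neq s t ∧ eq i j)

-- K4^Δ: vertex k ↦ (i , r) ∈ Fin 4 × Fin 3, interpreted as the vertex of the
-- triangle of i that is joined to the triangle of j = punchIn i r (j ≠ i).
-- (i,j) ~ (i',j') iff (i = i' and j ≠ j') or (i = j' and j = i').
K4Δadj : Fin 12 → Fin 12 → Bool
K4Δadj x y with remQuot {4} 3 x | remQuot {4} 3 y
... | (i , r) | (i' , r') =
  (eq i i' ∧ neq (punchIn i r) (punchIn i' r'))
  ∨ (eq i (punchIn i' r') ∧ eq (punchIn i r) i')

-- "G is isomorphic to the graph with adjacency A on Fin m": a bijection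
-- Fin (n G) ↔ Fin m carrying adj G to A.  (Stated this way so that the
-- specific graphs need no bundled symmetry proofs.)
IsoTo : (G : Graph) (m : ℕ) → (Fin m → Fin m → Bool) → Set
IsoTo G m A = Σ (Fin (n G) ↔ Fin m) λ f →
  ∀ u v → adj G u v ≡ A (Inverse.to f u) (Inverse.to f v)

-- Measure distances from a vertex of degree 1 and colour the edges greedily, those farthest from this
-- root first, where the weight of an edge uv is d(u) + d(v). When uv is coloured, the coloured edges
-- in conflict with it have weight at least that of uv, and they lie among at most six edges near u
-- and v: edges at a parent of u or v are lighter than uv; at the root, degree 1 leaves only the far
-- side of uv; and if d(v) = d(u) + 1, claw-freeness at u makes the third neighbour of u adjacent to
-- v or to the parent of u, and claw-freeness at v makes two further neighbours of v adjacent.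

module Submission where

open import Defs hiding (sym)
open import Data.Nat using (ℕ; zero; suc; _+_; _*_; _≤_; _<_; z≤n; s≤s; s≤s⁻¹)
open import Data.Nat.Properties
  using ( ≤-reflexive; ≤-trans; ≤-antisym; <-≤-trans; ≤-<-trans; ≤∧≢⇒<; ≮⇒≥; <⇒≱; <⇒≢; 1+n≰n
        ; n≮n; n<1+n; n≤1+n; m<n⇒m<1+n; +-comm; +-mono-≤; +-monoʳ-≤; +-monoʳ-<; *-monoˡ-≤; <-cmp
        ; ≤-decTotalOrder)
  renaming (_≟_ to _≟ℕ_)
open import Data.Nat.ListAction using (sum)
open import Data.Bool using (true; false; if_then_else_)
import Data.Bool.Properties as Bool
open import Data.Fin using (Fin; zero)
import Data.Fin as Fin
open import Data.Fin.Properties using (_≟_; _≤?_; ≤-total; any?; pigeonhole; <-irrefl)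
  renaming (≤-antisym to ≤ᶠ-antisym)
open import Data.List using (List; []; _∷_; _++_; length; lookup; map; concatMap; filter; allFin)
open import Data.List.Properties using (length-++; length-map; filter-notAll)
open import Data.List.Membership.Propositional using (_∈_; _∉_)
open import Data.List.Membership.Propositional.Properties
  using (∈-allFin; ∈-filter⁺; ∈-filter⁻; ∈-map⁺; ∈-map⁻; ∈-++⁺ˡ; ∈-++⁺ʳ; ∈-concatMap⁺; ∈-concatMap⁻)
open import Data.List.Relation.Unary.Any using (Any; here; there; index)
import Data.List.Relation.Unary.Any as Any
open import Data.List.Relation.Unary.Any.Properties using (lookup-index)
import Data.List.Relation.Unary.All as All
open import Data.List.Relation.Unary.AllPairs using (AllPairs; []; _∷_)
open import Data.List.Relation.Unary.Linked.Properties using (Linked⇒AllPairs)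
open import Data.List.Relation.Binary.Subset.Propositional using (_⊆_)
open import Data.List.Relation.Binary.Subset.Propositional.Properties using (xs⊆xs++ys; xs⊆ys++xs)
open import Data.List.Relation.Binary.Permutation.Propositional using (↭-sym)
open import Data.List.Relation.Binary.Permutation.Propositional.Properties using (∈-resp-↭)
import Data.List.Sort as Sort
open import Data.Product using (Σ; ∃; ∃₂; _×_; _,_; proj₁; proj₂; uncurry)
open import Data.Product.Properties using (≡-dec)
open import Data.Sum using (_⊎_; inj₁; inj₂)
import Data.Sum as Sum
open import Data.Empty using (⊥-elim)
open import Function using (_∘_; id)
open import Relation.Nullary using (¬_; ¬?; Dec; yes; no; contradiction; _×-dec_; _⊎-dec_)
open import Relation.Nullary.Decidable using (decidable-stable)
open import Relation.Binary.Bundles using (DecTotalOrder)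
open import Relation.Binary.Definitions using (Decidable; DecidableEquality; tri<; tri≈; tri>)
import Relation.Binary.Construct.On as On
open import Relation.Binary.PropositionalEquality

length-concatMap≤ : ∀ {A B : Set} (f : A → List B) (xs : List A) {b} →
  (∀ {x} → x ∈ xs → length (f x) ≤ b) → length (concatMap f xs) ≤ length xs * b
length-concatMap≤ f [] bound = z≤n
length-concatMap≤ f (x ∷ xs) bound =
  ≤-trans (≤-reflexive (length-++ (f x)))
    (+-mono-≤ (bound (here refl)) (length-concatMap≤ f xs (bound ∘ there)))

length-++≤ : ∀ {A : Set} (xs ys : List A) {a b} → length xs ≤ a → length ys ≤ b → length (xs ++ ys) ≤ a + b
length-++≤ xs ys xs≤ ys≤ = ≤-trans (≤-reflexive (length-++ xs)) (+-mono-≤ xs≤ ys≤)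

length≤1⇒∈-unique : ∀ {A : Set} {xs : List A} {a b} → length xs ≤ 1 → a ∈ xs → b ∈ xs → a ≡ b
length≤1⇒∈-unique {xs = _ ∷ []} _ (here refl) (here refl) = refl
length≤1⇒∈-unique {xs = _ ∷ _ ∷ _} (s≤s ()) _ _

least : (P : ℕ → Set) → (∀ k → Dec (P k)) → ∀ {n} → P n → Σ ℕ λ m → P m × (∀ {k} → k < m → ¬ P k)
least P P? {zero} p0 = 0 , p0 , λ ()
least P P? {suc n} pn with P? 0
... | yes p0 = 0 , p0 , λ ()
... | no ¬p0 with least (P ∘ suc) (P? ∘ suc) pn
... | m , pm , below = suc m , pm , λ { {zero} _ → ¬p0 ; {suc k} k<m → below (s≤s⁻¹ k<m) }

missing-colour : ∀ {k} (xs : List (Fin (suc k))) → length xs ≤ k → ∃ λ c → c ∉ xs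
missing-colour {k} xs len with any? {n = suc k} (λ c → ¬? (Any.any? (c ≟_) xs))
... | yes found = found
... | no none = contradiction (pigeonhole (s≤s len) (index ∘ everywhere)) no-collision
  where
  everywhere : ∀ c → c ∈ xs
  everywhere c = decidable-stable (Any.any? (c ≟_) xs) λ c∉xs → none (c , c∉xs)
  no-collision : ¬ ∃₂ λ i j → i Fin.< j × index (everywhere i) ≡ index (everywhere j)
  no-collision (i , j , i<j , same) = <-irrefl i≡j i<j
    where
    i≡j : i ≡ j
    i≡j = trans (lookup-index (everywhere i))
            (trans (cong (lookup xs) same) (sym (lookup-index (everywhere j))))

module Greedy {A : Set} (_≟ᴬ_ : DecidableEquality A) (_#_ : A → A → Set)
         (#-sym : ∀ {a b} → a # b → b # a) (#-irrefl : ∀ {a} → ¬ a # a) where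

  data Degenerate (k : ℕ) : List A → Set where
    [] : Degenerate k []
    _∷_ : ∀ {a rest} →
          (Σ (List A) λ C → length C ≤ k × (∀ {b} → b ∈ rest → a # b → b ∈ C)) →
          Degenerate k rest → Degenerate k (a ∷ rest)

  ProperOn : ∀ {k} → List A → (A → Fin k) → Set
  ProperOn L f = ∀ {a b} → a ∈ L → b ∈ L → a # b → f a ≢ f b

  private
    recolour : ∀ {k} → (A → Fin k) → A → Fin k → A → Fin k
    recolour f a c x with x ≟ᴬ a
    ... | yes _ = c
    ... | no _ = f x

    recolour-proper : ∀ {k} (f : A → Fin k) a c rest → ProperOn rest f →
      (∀ {b} → b ∈ rest → a # b → c ≢ f b) → ProperOn (a ∷ rest) (recolour f a c)
    recolour-proper f a c rest proper fresh {x} {y} x∈ y∈ x#y with x ≟ᴬ a | y ≟ᴬ a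
    ... | yes refl | yes refl = contradiction x#y #-irrefl
    ... | yes refl | no y≢a = fresh (Any.tail y≢a y∈) x#y
    ... | no x≢a | yes refl = fresh (Any.tail x≢a x∈) (#-sym x#y) ∘ sym
    ... | no x≢a | no y≢a = proper (Any.tail x≢a x∈) (Any.tail y≢a y∈) x#y

  greedy-colouring : ∀ {k L} → Degenerate k L → Σ (A → Fin (suc k)) (ProperOn L)
  greedy-colouring [] = (λ _ → zero) , λ ()
  greedy-colouring {k} {a ∷ rest} ((C , len , covers) ∷ deg) with greedy-colouring deg
  ... | f , proper with missing-colour (map f C) (subst (_≤ k) (sym (length-map f C)) len)
  ... | c , c∉ = recolour f a c , recolour-proper f a c rest proper fresh
    where
    fresh : ∀ {b} → b ∈ rest → a # b → c ≢ f b
    fresh b∈ a#b refl = c∉ (∈-map⁺ f (covers b∈ a#b))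

module _ {m : ℕ} {u v x y : Fin m} where

  SameEdge-flipʳ : SameEdge u v x y → SameEdge u v y x
  SameEdge-flipʳ (inj₁ (u≡x , v≡y)) = inj₂ (u≡x , v≡y)
  SameEdge-flipʳ (inj₂ (u≡y , v≡x)) = inj₁ (u≡y , v≡x)

  SameEdge-flipˡ : SameEdge u v x y → SameEdge v u x y
  SameEdge-flipˡ (inj₁ (u≡x , v≡y)) = inj₂ (v≡y , u≡x)
  SameEdge-flipˡ (inj₂ (u≡y , v≡x)) = inj₁ (v≡x , u≡y)

  SameEdge-sym : SameEdge u v x y → SameEdge x y u v
  SameEdge-sym (inj₁ (u≡x , v≡y)) = inj₁ (sym u≡x , sym v≡y)
  SameEdge-sym (inj₂ (u≡y , v≡x)) = inj₂ (sym v≡x , sym u≡y)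

module Neighbourhood (G : Graph) where

  V : Set
  V = Fin (n G)

  Edge : Set
  Edge = V × V

  adj? : Decidable (Adj G)
  adj? u v = adj G u v Bool.≟ true

  Adj-sym : ∀ {u v} → Adj G u v → Adj G v u
  Adj-sym {u} {v} u~v = trans (Graph.sym G v u) u~v

  Adj-irrefl : ∀ {v} → ¬ Adj G v v
  Adj-irrefl {v} v~v with trans (sym v~v) (irrefl G v)
  ... | ()

  Adj⇒≢ : ∀ {u v} → Adj G u v → u ≢ v
  Adj⇒≢ u~v refl = Adj-irrefl u~v

  Close-sym : ∀ {a b} → Close G a b → Close G b a
  Close-sym (inj₁ a≡b) = inj₁ (sym a≡b)
  Close-sym (inj₂ a~b) = inj₂ (Adj-sym a~b)

  Within2-flipˡ : ∀ {u v x y} → Within2 G u v x y → Within2 G v u x y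
  Within2-flipˡ (inj₁ ux) = inj₂ (inj₂ (inj₁ ux))
  Within2-flipˡ (inj₂ (inj₁ uy)) = inj₂ (inj₂ (inj₂ uy))
  Within2-flipˡ (inj₂ (inj₂ (inj₁ vx))) = inj₁ vx
  Within2-flipˡ (inj₂ (inj₂ (inj₂ vy))) = inj₂ (inj₁ vy)

  Within2-flipʳ : ∀ {u v x y} → Within2 G u v x y → Within2 G u v y x
  Within2-flipʳ (inj₁ ux) = inj₂ (inj₁ ux)
  Within2-flipʳ (inj₂ (inj₁ uy)) = inj₁ uy
  Within2-flipʳ (inj₂ (inj₂ (inj₁ vx))) = inj₂ (inj₂ (inj₂ vx))
  Within2-flipʳ (inj₂ (inj₂ (inj₂ vy))) = inj₂ (inj₂ (inj₁ vy))

  Within2-sym : ∀ {u v x y} → Within2 G u v x y → Within2 G x y u v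
  Within2-sym (inj₁ ux) = inj₁ (Close-sym ux)
  Within2-sym (inj₂ (inj₁ uy)) = inj₂ (inj₂ (inj₁ (Close-sym uy)))
  Within2-sym (inj₂ (inj₂ (inj₁ vx))) = inj₂ (inj₁ (Close-sym vx))
  Within2-sym (inj₂ (inj₂ (inj₂ vy))) = inj₂ (inj₂ (inj₂ (Close-sym vy)))

  nbrs : V → List V
  nbrs x = filter (adj? x) (allFin (n G))

  ∈-nbrs⁺ : ∀ {x y} → Adj G x y → y ∈ nbrs x
  ∈-nbrs⁺ {y = y} x~y = ∈-filter⁺ (adj? _) (∈-allFin y) x~y

  ∈-nbrs⁻ : ∀ {x y} → y ∈ nbrs x → Adj G x y
  ∈-nbrs⁻ y∈ = proj₂ (∈-filter⁻ (adj? _) {xs = allFin (n G)} y∈)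

  length-nbrs : ∀ x → length (nbrs x) ≡ degree G x
  length-nbrs x = count (allFin (n G))
    where
    count : ∀ ys → length (filter (adj? x) ys) ≡ sum (map (λ w → if adj G x w then 1 else 0) ys)
    count [] = refl
    count (y ∷ ys) with adj G x y
    ... | true = cong suc (count ys)
    ... | false = count ys

  otherNbrs : V → V → List V
  otherNbrs x a = filter (¬? ∘ (_≟ a)) (nbrs x)

  otherNbrs₂ : V → V → V → List V
  otherNbrs₂ x a b = filter (¬? ∘ (_≟ b)) (otherNbrs x a)

  ∈-otherNbrs⁺ : ∀ {x a y} → Adj G x y → y ≢ a → y ∈ otherNbrs x a
  ∈-otherNbrs⁺ x~y y≢a = ∈-filter⁺ (¬? ∘ (_≟ _)) (∈-nbrs⁺ x~y) y≢a

  ∈-otherNbrs⁻ : ∀ {x a y} → y ∈ otherNbrs x a → Adj G x y × y ≢ a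
  ∈-otherNbrs⁻ y∈ with ∈-filter⁻ (¬? ∘ (_≟ _)) y∈
  ... | y∈nbrs , y≢a = ∈-nbrs⁻ y∈nbrs , y≢a

  ∈-otherNbrs₂⁺ : ∀ {x a b y} → Adj G x y → y ≢ a → y ≢ b → y ∈ otherNbrs₂ x a b
  ∈-otherNbrs₂⁺ x~y y≢a y≢b = ∈-filter⁺ (¬? ∘ (_≟ _)) (∈-otherNbrs⁺ x~y y≢a) y≢b

  ∈-otherNbrs₂⁻ : ∀ {x a b y} → y ∈ otherNbrs₂ x a b → Adj G x y × y ≢ a × y ≢ b
  ∈-otherNbrs₂⁻ y∈ with ∈-filter⁻ (¬? ∘ (_≟ _)) y∈
  ... | y∈others , y≢b = proj₁ (∈-otherNbrs⁻ y∈others) , proj₂ (∈-otherNbrs⁻ y∈others) , y≢b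

  otherNbrs⊂nbrs : ∀ {x a} → Adj G x a → length (otherNbrs x a) < length (nbrs x)
  otherNbrs⊂nbrs x~a = filter-notAll (¬? ∘ (_≟ _)) _ (Any.map (λ a≡ a≢ → a≢ (sym a≡)) (∈-nbrs⁺ x~a))

  otherNbrs₂⊂otherNbrs : ∀ {x a b} → Adj G x b → a ≢ b → length (otherNbrs₂ x a b) < length (otherNbrs x a)
  otherNbrs₂⊂otherNbrs x~b a≢b =
    filter-notAll (¬? ∘ (_≟ _)) _ (Any.map (λ b≡ b≢ → b≢ (sym b≡)) (∈-otherNbrs⁺ x~b (a≢b ∘ sym)))

  edge : V → V → Edge
  edge x y with x ≤? y
  ... | yes _ = x , y
  ... | no _ = y , x

  edge-sym : ∀ x y → edge x y ≡ edge y x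
  edge-sym x y with x ≤? y | y ≤? x
  ... | yes x≤y | yes y≤x rewrite ≤ᶠ-antisym x≤y y≤x = refl
  ... | yes _ | no _ = refl
  ... | no _ | yes _ = refl
  ... | no x≰y | no y≰x with ≤-total x y
  ... | inj₁ x≤y = contradiction x≤y x≰y
  ... | inj₂ y≤x = contradiction y≤x y≰x

  edge-elim : (P : V → V → Set) → (∀ {a b} → P a b → P b a) → ∀ {x y} → P x y → uncurry P (edge x y)
  edge-elim P flip {x} {y} p with x ≤? y
  ... | yes _ = p
  ... | no _ = flip p

  edge-idem : ∀ x y → uncurry edge (edge x y) ≡ edge x y
  edge-idem x y = edge-elim (λ a b → edge a b ≡ edge x y) (λ {a} {b} e → trans (edge-sym b a) e) refl

  fan : V → List V → List Edge
  fan z X = map (edge z) X ++ concatMap (λ x → map (edge x) (otherNbrs x z)) X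

  otherEdges₂ : V → V → V → List Edge
  otherEdges₂ x a b = map (edge x) (otherNbrs₂ x a b)

  ∈-edge-sym : ∀ {x y C} → edge x y ∈ C → edge y x ∈ C
  ∈-edge-sym {x} {y} {C} = subst (_∈ C) (edge-sym x y)

  ∈-fan : ∀ {z X x y} → x ∈ X → Adj G x y → edge x y ∈ fan z X
  ∈-fan {z} {X} {x} {y} x∈ x~y with y ≟ z
  ... | yes refl = ∈-edge-sym (∈-++⁺ˡ (∈-map⁺ (edge z) x∈))
  ... | no y≢z = ∈-++⁺ʳ (map (edge z) X) (∈-concatMap⁺ (λ x → map (edge x) (otherNbrs x z))
                   (Any.map (λ { refl → ∈-map⁺ (edge x) (∈-otherNbrs⁺ x~y y≢z) }) x∈))

  clawFree⇒Adj : ClawFree G → ∀ {x a b c} → Adj G x a → Adj G x b → Adj G x c →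
    a ≢ b → a ≢ c → b ≢ c → ¬ Adj G a b → ¬ Adj G a c → Adj G b c
  clawFree⇒Adj clawFree x~a x~b x~c a≢b a≢c b≢c a≁b a≁c =
    decidable-stable (adj? _ _) λ b≁c →
      clawFree (_ , _ , _ , _ , x~a , x~b , x~c , a≢b , a≢c , b≢c , a≁b , a≁c , b≁c)

  module MaxDegree3 (subcubic : Subcubic G) where

    length-nbrs≤3 : ∀ x → length (nbrs x) ≤ 3
    length-nbrs≤3 x = ≤-trans (≤-reflexive (length-nbrs x)) (subcubic x)

    length-otherNbrs≤2 : ∀ {x a} → Adj G x a → length (otherNbrs x a) ≤ 2
    length-otherNbrs≤2 x~a = s≤s⁻¹ (<-≤-trans (otherNbrs⊂nbrs x~a) (length-nbrs≤3 _))

    length-otherNbrs₂≤1 : ∀ {x a b} → Adj G x a → Adj G x b → a ≢ b → length (otherNbrs₂ x a b) ≤ 1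
    length-otherNbrs₂≤1 x~a x~b a≢b =
      s≤s⁻¹ (<-≤-trans (otherNbrs₂⊂otherNbrs x~b a≢b) (length-otherNbrs≤2 x~a))

    length-fan≤ : ∀ {z X k} → (∀ {x} → x ∈ X → Adj G z x) → length X ≤ k → length (fan z X) ≤ k + k * 2
    length-fan≤ {z} {X} z~X len =
      length-++≤ (map (edge z) X) _ (≤-trans (≤-reflexive (length-map (edge z) X)) len)
        (≤-trans (length-concatMap≤ _ X λ {x} x∈ →
                    ≤-trans (≤-reflexive (length-map (edge x) (otherNbrs x z)))
                      (length-otherNbrs≤2 (Adj-sym (z~X x∈))))
                 (*-monoˡ-≤ 2 len))

    length-otherEdges₂≤1 : ∀ {x a b} → Adj G x a → Adj G x b → a ≢ b → length (otherEdges₂ x a b) ≤ 1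
    length-otherEdges₂≤1 {x} {a} {b} x~a x~b a≢b =
      ≤-trans (≤-reflexive (length-map (edge x) (otherNbrs₂ x a b))) (length-otherNbrs₂≤1 x~a x~b a≢b)

    third-neighbour : ∀ {u v w} → Adj G u v → Adj G u w → v ≢ w →
      (∀ {z} → Adj G u z → z ≡ v ⊎ z ≡ w) ⊎
      Σ V λ u' → Adj G u u' × u' ≢ v × u' ≢ w × (∀ {z} → Adj G u z → z ≡ v ⊎ z ≡ w ⊎ z ≡ u')
    third-neighbour {u} {v} {w} u~v u~w v≢w
      with otherNbrs₂ u v w | length-otherNbrs₂≤1 u~v u~w v≢w | ∈-otherNbrs₂⁻ {u} {v} {w} | classify
      where
      classify : ∀ {z} → Adj G u z → z ≡ v ⊎ z ≡ w ⊎ z ∈ otherNbrs₂ u v w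
      classify {z} u~z with z ≟ v | z ≟ w
      ... | yes z≡v | _ = inj₁ z≡v
      ... | no _ | yes z≡w = inj₂ (inj₁ z≡w)
      ... | no z≢v | no z≢w = inj₂ (inj₂ (∈-otherNbrs₂⁺ u~z z≢v z≢w))
    ... | [] | _ | _ | cl = inj₁ λ u~z → Sum.map₂ (Sum.[ id , (λ ()) ]) (cl u~z)
    ... | _ ∷ _ ∷ _ | s≤s () | _ | _
    ... | u' ∷ [] | _ | sound | cl with sound (here refl)
    ...   | u~u' , u'≢v , u'≢w =
            inj₂ (u' , u~u' , u'≢v , u'≢w , λ u~z → Sum.map₂ (Sum.map₂ λ { (here e) → e }) (cl u~z))

    others-cases : ∀ {v u} → Adj G v u →
      (Σ (List V) λ X → length X ≤ 1 × (∀ {z} → z ∈ X → Adj G v z) × (∀ {z} → Adj G v z → z ≢ u → z ∈ X)) ⊎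
      (Σ V λ a → Σ V λ b → a ≢ b × Adj G v a × Adj G v b × a ≢ u × b ≢ u ×
        (∀ {z} → Adj G v z → z ≢ u → z ≡ a ⊎ z ≡ b))
    others-cases {v} {u} v~u
      with otherNbrs v u | length-otherNbrs≤2 v~u | ∈-otherNbrs⁻ {v} {u} | ∈-otherNbrs⁺ {v} {u}
    ... | [] | _ | sound | complete = inj₁ ([] , z≤n , proj₁ ∘ sound , complete)
    ... | a ∷ [] | _ | sound | complete = inj₁ (a ∷ [] , s≤s z≤n , proj₁ ∘ sound , complete)
    ... | _ ∷ _ ∷ _ ∷ _ | s≤s (s≤s ()) | _ | _
    ... | a ∷ b ∷ [] | _ | sound | complete with a ≟ b
    ...   | yes refl = inj₁ (a ∷ [] , s≤s z≤n , proj₁ ∘ sound ∘ there , λ v~z z≢u → dedup (complete v~z z≢u))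
      where
      dedup : ∀ {z} → z ∈ a ∷ a ∷ [] → z ∈ a ∷ []
      dedup (here e) = here e
      dedup (there z∈) = z∈
    ...   | no a≢b with sound (here refl) | sound (there (here refl))
    ...     | v~a , a≢u | v~b , b≢u =
              inj₂ (a , b , a≢b , v~a , v~b , a≢u , b≢u , λ v~z z≢u → pair (complete v~z z≢u))
      where
      pair : ∀ {z} → z ∈ a ∷ b ∷ [] → z ≡ a ⊎ z ≡ b
      pair (here e) = inj₁ e
      pair (there (here e)) = inj₂ e

module Distance (G : Graph) (root : Fin (n G)) (connected : Connected G) where
  open Neighbourhood G

  WalkToRoot≤ : ℕ → V → Set
  WalkToRoot≤ zero x = x ≡ root
  WalkToRoot≤ (suc k) x = WalkToRoot≤ k x ⊎ Σ V λ y → Adj G x y × WalkToRoot≤ k y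

  walkToRoot≤? : ∀ k x → Dec (WalkToRoot≤ k x)
  walkToRoot≤? zero x = x ≟ root
  walkToRoot≤? (suc k) x = walkToRoot≤? k x ⊎-dec any? (λ y → adj? x y ×-dec walkToRoot≤? k y)

  reach⇒walkToRoot≤ : ∀ {x} → Reach G x root → Σ ℕ λ k → WalkToRoot≤ k x
  reach⇒walkToRoot≤ here = 0 , refl
  reach⇒walkToRoot≤ (step x~w w↝root) with reach⇒walkToRoot≤ w↝root
  ... | k , walk = suc k , inj₂ (_ , x~w , walk)

  private
    shortest : ∀ x → Σ ℕ λ m → WalkToRoot≤ m x × (∀ {k} → k < m → ¬ WalkToRoot≤ k x)
    shortest x = least (λ k → WalkToRoot≤ k x) (λ k → walkToRoot≤? k x)
                   (proj₂ (reach⇒walkToRoot≤ (connected x root)))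

  dist : V → ℕ
  dist x = proj₁ (shortest x)

  dist-walk : ∀ x → WalkToRoot≤ (dist x) x
  dist-walk x = proj₁ (proj₂ (shortest x))

  dist-minimal : ∀ {k x} → WalkToRoot≤ k x → dist x ≤ k
  dist-minimal {k} {x} walk = ≮⇒≥ λ k<dist → proj₂ (proj₂ (shortest x)) k<dist walk

  dist≡0⇒root : ∀ {x} → dist x ≡ 0 → x ≡ root
  dist≡0⇒root {x} d≡0 = subst (λ k → WalkToRoot≤ k x) d≡0 (dist-walk x)

  dist-Adj : ∀ {x y} → Adj G x y → dist x ≤ suc (dist y)
  dist-Adj x~y = dist-minimal (inj₂ (_ , x~y , dist-walk _))

  dist-parent : ∀ {x k} → dist x ≡ suc k → Σ V λ w → Adj G x w × dist w ≡ k
  dist-parent {x} {k} d≡ with subst (λ j → WalkToRoot≤ j x) d≡ (dist-walk x)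
  ... | inj₁ short = contradiction (subst (_≤ k) d≡ (dist-minimal short)) (n≮n k)
  ... | inj₂ (w , x~w , walk) =
    w , x~w , ≤-antisym (dist-minimal walk) (s≤s⁻¹ (subst (_≤ suc (dist w)) d≡ (dist-Adj x~w)))

  dist-zero-or-parent : ∀ x → dist x ≡ 0 ⊎ Σ ℕ λ j → dist x ≡ suc j × Σ V λ w → Adj G x w × dist w ≡ j
  dist-zero-or-parent x with dist x | dist-parent {x}
  ... | zero | _ = inj₁ refl
  ... | suc j | parent = inj₂ (j , refl , parent refl)

module LocalCover (G : Graph) (root : Fin (n G)) (connected : Connected G)
                  (leaf : degree G root ≡ 1) (clawFree : ClawFree G) (subcubic : Subcubic G) where
  open Neighbourhood G
  open MaxDegree3 subcubic
  open Distance G root connected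

  weight : V → V → ℕ
  weight u v = dist u + dist v

  NoCloser : V → V → V → V → Set
  NoCloser u v x y = Adj G x y × ¬ SameEdge u v x y × weight u v ≤ weight x y

  NoCloser-flip : ∀ {u v x y} → NoCloser u v x y → NoCloser u v y x
  NoCloser-flip {x = x} {y} (x~y , notSame , w≤) =
    Adj-sym x~y , notSame ∘ SameEdge-flipʳ , ≤-trans w≤ (≤-reflexive (+-comm (dist x) (dist y)))

  NoCloser-swap : ∀ {u v x y} → NoCloser u v x y → NoCloser v u x y
  NoCloser-swap {u} {v} (x~y , notSame , w≤) =
    x~y , notSame ∘ SameEdge-flipˡ , ≤-trans (≤-reflexive (+-comm (dist v) (dist u))) w≤

  lighter : ∀ {u v x y} → weight x y < weight u v → ¬ NoCloser u v x y
  lighter w< (_ , _ , w≤) = <⇒≱ w< w≤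

  shallow : ∀ {u v x y} j → j + suc j < weight u v → dist x ≤ j → ¬ NoCloser u v x y
  shallow j bound dx nc@(x~y , _) =
    lighter (≤-<-trans (+-mono-≤ dx (≤-trans (dist-Adj (Adj-sym x~y)) (s≤s dx))) bound) nc

  CoversAt : V → V → List Edge → V → Set
  CoversAt u v C z = ∀ {y} → NoCloser u v z y → edge z y ∈ C

  coversAt-⊆ : ∀ {u v C D z} → C ⊆ D → CoversAt u v C z → CoversAt u v D z
  coversAt-⊆ C⊆D covers = C⊆D ∘ covers

  fan-coversAt : ∀ {u v a X z} → z ∈ X → CoversAt u v (fan a X) z
  fan-coversAt z∈ (z~y , _) = ∈-fan z∈ z~y

  Cover : V → V → Set
  Cover u v = Σ (List Edge) λ C → length C ≤ 6 ×
    (∀ {z} → Adj G u z → z ≢ v → CoversAt u v C z) × (∀ {z} → Adj G v z → z ≢ u → CoversAt u v C z)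

  Cover-sym : ∀ {u v} → Cover v u → Cover u v
  Cover-sym (C , len , atV , atU) =
    C , len , (λ u~z z≢v → atU u~z z≢v ∘ NoCloser-swap) , (λ v~z z≢u → atV v~z z≢u ∘ NoCloser-swap)

  Cover⇒covers-conflicts : ∀ {u v} → (cover : Cover u v) → ∀ {x y} → NoCloser u v x y →
    Within2 G u v x y → edge x y ∈ proj₁ cover
  Cover⇒covers-conflicts {u} {v} (C , _ , atU , atV) = within
    where
    atEnd : ∀ {a b y} → (∀ {z} → Adj G a z → z ≢ b → CoversAt u v C z) →
            (SameEdge a b a y → SameEdge u v a y) → NoCloser u v a y → edge a y ∈ C
    atEnd {b = b} {y} atA same nc@(a~y , notSame , _) with y ≟ b
    ... | yes refl = ⊥-elim (notSame (same (inj₁ (refl , refl))))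
    ... | no y≢b = ∈-edge-sym (atA a~y y≢b (NoCloser-flip nc))
    near : ∀ {x y} → NoCloser u v x y → Close G u x ⊎ Close G v x → edge x y ∈ C
    near nc (inj₁ (inj₁ refl)) = atEnd atU id nc
    near nc (inj₂ (inj₁ refl)) = atEnd atV SameEdge-flipˡ nc
    near {x} nc (inj₁ (inj₂ u~x)) with x ≟ v
    ... | yes refl = near nc (inj₂ (inj₁ refl))
    ... | no x≢v = atU u~x x≢v nc
    near {x} nc (inj₂ (inj₂ v~x)) with x ≟ u
    ... | yes refl = near nc (inj₁ (inj₁ refl))
    ... | no x≢u = atV v~x x≢u nc
    within : ∀ {x y} → NoCloser u v x y → Within2 G u v x y → edge x y ∈ C
    within nc (inj₁ ux) = near nc (inj₁ ux)
    within nc (inj₂ (inj₂ (inj₁ vx))) = near nc (inj₂ vx)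
    within nc (inj₂ (inj₁ uy)) = ∈-edge-sym (near (NoCloser-flip nc) (inj₁ uy))
    within nc (inj₂ (inj₂ (inj₂ vy))) = ∈-edge-sym (near (NoCloser-flip nc) (inj₂ vy))

  corner-coversAt : ∀ {u v C a p q} → edge a p ∈ C → edge a q ∈ C →
    otherEdges₂ a p q ⊆ C → CoversAt u v C a
  corner-coversAt {a = a} {p} {q} ap∈ aq∈ rest {y} (a~y , _) with y ≟ p | y ≟ q
  ... | yes refl | _ = ap∈
  ... | no _ | yes refl = aq∈
  ... | no y≢p | no y≢q = rest (∈-map⁺ (edge a) (∈-otherNbrs₂⁺ a~y y≢p y≢q))

  far-cover : ∀ {u v} → Adj G u v → (∀ {z} → Adj G u z → z ≢ v → CoversAt u v [] z) → Cover u v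
  far-cover {u} {v} u~v atU =
    C , length-fan≤ (proj₁ ∘ ∈-otherNbrs⁻) (length-otherNbrs≤2 (Adj-sym u~v)) ,
    (λ u~z z≢v → coversAt-⊆ (λ ()) (atU u~z z≢v)) ,
    (λ v~z z≢u → fan-coversAt (∈-otherNbrs⁺ v~z z≢u))
    where
    C : List Edge
    C = fan v (otherNbrs v u)

  root-cover : ∀ {u v} → Adj G u v → dist u ≡ 0 → Cover u v
  root-cover {u} u~v du =
    far-cover u~v λ u~z z≢v → ⊥-elim (z≢v (length≤1⇒∈-unique only (∈-nbrs⁺ u~z) (∈-nbrs⁺ u~v)))
    where
    only : length (nbrs u) ≤ 1
    only = ≤-reflexive (trans (length-nbrs u) (trans (cong (degree G) (dist≡0⇒root du)) leaf))

  level-cover : ∀ {u v} → Adj G u v → dist u ≡ dist v → Cover u v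
  level-cover {u} {v} u~v du≡dv with dist-zero-or-parent u
  ... | inj₁ du = ⊥-elim (Adj⇒≢ u~v (trans (dist≡0⇒root du) (sym (dist≡0⇒root (trans (sym du≡dv) du)))))
  ... | inj₂ (j , du , wu , u~wu , dwu) with dist-parent (trans (sym du≡dv) du)
  ... | wv , v~wv , dwv =
    fan u Ou ++ fan v Ov ,
    length-++≤ (fan u Ou) _ (side-length u~v u~wu dv dwu) (side-length v~u v~wv du dwv) ,
    (λ u~z z≢v → coversAt-⊆ (xs⊆xs++ys _ _) (side u~wu dwu u~z z≢v)) ,
    (λ v~z z≢u → coversAt-⊆ (xs⊆ys++xs _ (fan u Ou)) (side v~wv dwv v~z z≢u))
    where
    v~u : Adj G v u
    v~u = Adj-sym u~v
    Ou Ov : List V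
    Ou = otherNbrs₂ u v wu
    Ov = otherNbrs₂ v u wv
    dv : dist v ≡ suc j
    dv = trans (sym du≡dv) du
    bound : j + suc j < weight u v
    bound = ≤-reflexive (sym (cong₂ _+_ du dv))
    side-length : ∀ {a b w} → Adj G a b → Adj G a w → dist b ≡ suc j → dist w ≡ j →
      length (fan a (otherNbrs₂ a b w)) ≤ 3
    side-length a~b a~w db dw = length-fan≤ (proj₁ ∘ ∈-otherNbrs₂⁻)
      (length-otherNbrs₂≤1 a~b a~w λ b≡w → <⇒≢ (n<1+n j) (trans (sym dw) (trans (cong dist (sym b≡w)) db)))
    side : ∀ {a b w z} → Adj G a w → dist w ≡ j → Adj G a z → z ≢ b →
      CoversAt u v (fan a (otherNbrs₂ a b w)) z
    side {w = w} {z} a~w dw a~z z≢b with z ≟ w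
    ... | yes refl = λ nc → ⊥-elim (shallow j bound (≤-reflexive dw) nc)
    ... | no z≢w = fan-coversAt (∈-otherNbrs₂⁺ a~z z≢b z≢w)

  module Rising {u v w : V} {j : ℕ} (u~v : Adj G u v) (u~w : Adj G u w)
                (du : dist u ≡ suc j) (dv : dist v ≡ suc (suc j)) (dw : dist w ≡ j) where

    bound : j + suc j < weight u v
    bound = ≤-trans (s≤s (+-monoʳ-≤ j (n≤1+n (suc j)))) (≤-reflexive (sym (cong₂ _+_ du dv)))

    v≁w : ¬ Adj G v w
    v≁w v~w = 1+n≰n (subst₂ _≤_ dv (cong suc dw) (dist-Adj v~w))

    v≢w : v ≢ w
    v≢w v≡w = <⇒≢ (m<n⇒m<1+n (n<1+n j)) (trans (sym dw) (trans (cong dist (sym v≡w)) dv))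

    w-shallow : ∀ {C} → CoversAt u v C w
    w-shallow nc = ⊥-elim (shallow j bound (≤-reflexive dw) nc)

    NbrsOfU : V → Set
    NbrsOfU u' = ∀ {z} → Adj G u z → z ≡ v ⊎ z ≡ w ⊎ z ≡ u'

    u-side : ∀ {C u'} → NbrsOfU u' → CoversAt u v C u' → ∀ {z} → Adj G u z → z ≢ v → CoversAt u v C z
    u-side u-nbrs atU' u~z z≢v with u-nbrs u~z
    ... | inj₁ z≡v = ⊥-elim (z≢v z≡v)
    ... | inj₂ (inj₁ refl) = w-shallow
    ... | inj₂ (inj₂ refl) = atU'

    triangle-cover : ∀ {u'} → Adj G u u' → NbrsOfU u' → Adj G v u' → Cover u v
    triangle-cover {u'} u~u' u-nbrs v~u' = C , len , u-side u-nbrs atU' , atV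
      where
      Zv : List Edge
      Zv = otherEdges₂ u' u v
      X : List V
      X = otherNbrs₂ v u u'
      C : List Edge
      C = edge u u' ∷ edge v u' ∷ Zv ++ fan v X
      atU' : CoversAt u v C u'
      atU' = corner-coversAt (∈-edge-sym (here refl)) (∈-edge-sym (there (here refl)))
               (there ∘ there ∘ xs⊆xs++ys Zv (fan v X))
      atV : ∀ {z} → Adj G v z → z ≢ u → CoversAt u v C z
      atV {z} v~z z≢u with z ≟ u'
      ... | yes refl = atU'
      ... | no z≢u' = coversAt-⊆ (there ∘ there ∘ xs⊆ys++xs (fan v X) Zv)
                        (fan-coversAt (∈-otherNbrs₂⁺ v~z z≢u z≢u'))
      len : length C ≤ 6
      len = s≤s (s≤s (length-++≤ Zv (fan v X)
              (length-otherEdges₂≤1 (Adj-sym u~u') (Adj-sym v~u') (Adj⇒≢ u~v))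
              (length-fan≤ (proj₁ ∘ ∈-otherNbrs₂⁻) (length-otherNbrs₂≤1 (Adj-sym u~v) v~u' (Adj⇒≢ u~u')))))

    module Sibling {u'} (u~u' : Adj G u u') (u-nbrs : NbrsOfU u') (v≁u' : ¬ Adj G v u')
                   (w~u' : Adj G w u') (du' : dist u' ≡ suc j) where

      Zw : List Edge
      Zw = otherEdges₂ u' u w

      atU' : CoversAt u v Zw u'
      atU' {y} nc@(u'~y , _) with y ≟ u | y ≟ w
      ... | yes refl | _ = ⊥-elim (lighter light nc)
        where
        light : weight u' u < weight u v
        light = subst₂ _<_ (sym (cong₂ _+_ du' du)) (sym (cong₂ _+_ du dv))
                  (+-monoʳ-< (suc j) (n<1+n (suc j)))
      ... | no _ | yes refl = ⊥-elim (shallow j bound (≤-reflexive dw) (NoCloser-flip nc))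
      ... | no y≢u | no y≢w = ∈-map⁺ (edge u') (∈-otherNbrs₂⁺ u'~y y≢u y≢w)

      u≁ : ∀ {a} → Adj G v a → ¬ Adj G u a
      u≁ v~a u~a with u-nbrs u~a
      ... | inj₁ refl = Adj-irrefl v~a
      ... | inj₂ (inj₁ refl) = v≁w v~a
      ... | inj₂ (inj₂ refl) = v≁u' v~a

      short-cover : ∀ {X} → length X ≤ 1 → (∀ {z} → z ∈ X → Adj G v z) →
        (∀ {z} → Adj G v z → z ≢ u → z ∈ X) → Cover u v
      short-cover {X} lenX v~X complete =
        fan v X ++ Zw , ≤-trans len (s≤s (s≤s (s≤s (s≤s z≤n)))) ,
        u-side u-nbrs (coversAt-⊆ (xs⊆ys++xs Zw (fan v X)) atU') ,
        λ v~z z≢u → coversAt-⊆ (xs⊆xs++ys (fan v X) Zw) (fan-coversAt (complete v~z z≢u))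
        where
        len : length (fan v X ++ Zw) ≤ 4
        len = length-++≤ (fan v X) Zw (length-fan≤ v~X lenX)
                (length-otherEdges₂≤1 (Adj-sym u~u') (Adj-sym w~u') (Adj⇒≢ u~w))

      pair-cover : ∀ {a b} → a ≢ b → Adj G v a → Adj G v b → a ≢ u → b ≢ u →
        (∀ {z} → Adj G v z → z ≢ u → z ≡ a ⊎ z ≡ b) → Cover u v
      pair-cover {a} {b} a≢b v~a v~b a≢u b≢u pair = C , len , u-side u-nbrs atU'' , atV
        where
        a~b : Adj G a b
        a~b = clawFree⇒Adj clawFree (Adj-sym u~v) v~a v~b (a≢u ∘ sym) (b≢u ∘ sym) a≢b (u≁ v~a) (u≁ v~b)
        Ta Tb C : List Edge
        Ta = otherEdges₂ a v b
        Tb = otherEdges₂ b v a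
        C = edge a v ∷ edge a b ∷ edge b v ∷ Ta ++ Tb ++ Zw
        rest : Ta ++ Tb ++ Zw ⊆ C
        rest = there ∘ there ∘ there
        atU'' : CoversAt u v C u'
        atU'' = coversAt-⊆ (rest ∘ xs⊆ys++xs _ Ta ∘ xs⊆ys++xs Zw Tb) atU'
        atV : ∀ {z} → Adj G v z → z ≢ u → CoversAt u v C z
        atV v~z z≢u with pair v~z z≢u
        ... | inj₁ refl = corner-coversAt (here refl) (there (here refl)) (rest ∘ xs⊆xs++ys Ta _)
        ... | inj₂ refl = corner-coversAt (there (there (here refl))) (∈-edge-sym (there (here refl)))
                            (rest ∘ xs⊆ys++xs _ Ta ∘ xs⊆xs++ys Tb Zw)
        len : length C ≤ 6
        len = s≤s (s≤s (s≤s (length-++≤ Ta _ (length-otherEdges₂≤1 (Adj-sym v~a) a~b (Adj⇒≢ v~b))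
                (length-++≤ Tb Zw (length-otherEdges₂≤1 (Adj-sym v~b) (Adj-sym a~b) (Adj⇒≢ v~a))
                  (length-otherEdges₂≤1 (Adj-sym u~u') (Adj-sym w~u') (Adj⇒≢ u~w))))))

      cover : Cover u v
      cover with others-cases (Adj-sym u~v)
      ... | inj₁ (X , lenX , v~X , complete) = short-cover lenX v~X complete
      ... | inj₂ (a , b , a≢b , v~a , v~b , a≢u , b≢u , pair) = pair-cover a≢b v~a v~b a≢u b≢u pair

    cover : Cover u v
    cover with third-neighbour u~v u~w v≢w
    ... | inj₁ u-nbrs = far-cover u~v λ u~z z≢v → Sum.[ ⊥-elim ∘ z≢v , (λ { refl → w-shallow }) ] (u-nbrs u~z)
    ... | inj₂ (u' , u~u' , u'≢v , u'≢w , u-nbrs) with adj? v u'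
    ... | yes v~u' = triangle-cover u~u' u-nbrs v~u'
    ... | no v≁u' with clawFree⇒Adj clawFree u~v u~w u~u' v≢w (u'≢v ∘ sym) (u'≢w ∘ sym) v≁w v≁u'
    ... | w~u' with dist u' ≟ℕ suc j
    ... | yes du' = Sibling.cover u~u' u-nbrs v≁u' w~u' du'
    ... | no du'≢ = far-cover u~v (u-side u-nbrs u'-shallow)
      where
      u'-shallow : CoversAt u v [] u'
      u'-shallow nc = ⊥-elim (shallow j bound
        (s≤s⁻¹ (≤∧≢⇒< (subst (λ k → dist u' ≤ suc k) dw (dist-Adj (Adj-sym w~u'))) du'≢)) nc)

  rising-cover : ∀ {u v} → Adj G u v → dist v ≡ suc (dist u) → Cover u v
  rising-cover {u} u~v dv with dist-zero-or-parent u
  ... | inj₁ du = root-cover u~v du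
  ... | inj₂ (j , du , w , u~w , dw) = Rising.cover u~v u~w du (trans dv (cong suc du)) dw

  cover : ∀ {u v} → Adj G u v → Cover u v
  cover {u} {v} u~v with <-cmp (dist u) (dist v)
  ... | tri≈ _ du≡dv _ = level-cover u~v du≡dv
  ... | tri< du<dv _ _ = rising-cover u~v (≤-antisym (dist-Adj (Adj-sym u~v)) du<dv)
  ... | tri> _ _ dv<du = Cover-sym (rising-cover (Adj-sym u~v) (≤-antisym (dist-Adj u~v) dv<du))

module StrongColouring (G : Graph) (root : Fin (n G)) (connected : Connected G)
                       (leaf : degree G root ≡ 1) (clawFree : ClawFree G) (subcubic : Subcubic G) where
  open Neighbourhood G
  open LocalCover G root connected leaf clawFree subcubic

  Conflict : Edge → Edge → Set
  Conflict (u , v) (x , y) = Adj G u v × Adj G x y × ¬ SameEdge u v x y × Within2 G u v x y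

  Conflict-sym : ∀ {e f} → Conflict e f → Conflict f e
  Conflict-sym (u~v , x~y , notSame , near) = x~y , u~v , notSame ∘ SameEdge-sym , Within2-sym near

  Conflict-irrefl : ∀ {e} → ¬ Conflict e e
  Conflict-irrefl (_ , _ , notSame , _) = notSame (inj₁ (refl , refl))

  Conflict-edge : ∀ {u v x y} → Adj G u v → Adj G x y → ¬ SameEdge u v x y → Within2 G u v x y →
    Conflict (edge u v) (edge x y)
  Conflict-edge {u} {v} {x} {y} u~v x~y notSame near =
    edge-elim (λ a b → Conflict (a , b) (edge x y)) flipˡ
      (edge-elim (λ c d → Conflict (u , v) (c , d)) flipʳ (u~v , x~y , notSame , near))
    where
    flipˡ : ∀ {a b f} → Conflict (a , b) f → Conflict (b , a) f
    flipˡ (a~b , f~ , notSame , near) = Adj-sym a~b , f~ , notSame ∘ SameEdge-flipˡ , Within2-flipˡ near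
    flipʳ : ∀ {e c d} → Conflict e (c , d) → Conflict e (d , c)
    flipʳ (e~ , c~d , notSame , near) = e~ , Adj-sym c~d , notSame ∘ SameEdge-flipʳ , Within2-flipʳ near

  edges : List Edge
  edges = concatMap (λ x → map (edge x) (nbrs x)) (allFin (n G))

  ∈-edges⁺ : ∀ {x y} → Adj G x y → edge x y ∈ edges
  ∈-edges⁺ {x} x~y = ∈-concatMap⁺ (λ x → map (edge x) (nbrs x))
    (Any.map (λ { refl → ∈-map⁺ (edge x) (∈-nbrs⁺ x~y) }) (∈-allFin x))

  ∈-edges⁻ : ∀ {e} → e ∈ edges → Σ V λ x → Σ V λ y → Adj G x y × e ≡ edge x y
  ∈-edges⁻ e∈ with Any.satisfied (∈-concatMap⁻ (λ x → map (edge x) (nbrs x)) {xs = allFin (n G)} e∈)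
  ... | x , e∈star with ∈-map⁻ (edge x) e∈star
  ... | y , y∈ , e≡ = x , y , ∈-nbrs⁻ y∈ , e≡

  ∈-edges⇒Adj : ∀ {u v} → (u , v) ∈ edges → Adj G u v
  ∈-edges⇒Adj e∈ with ∈-edges⁻ e∈
  ... | x , y , x~y , e≡ = subst (uncurry (Adj G)) (sym e≡) (edge-elim (Adj G) Adj-sym x~y)

  ∈-edges⇒normal : ∀ {e} → e ∈ edges → uncurry edge e ≡ e
  ∈-edges⇒normal e∈ with ∈-edges⁻ e∈
  ... | x , y , _ , refl = edge-idem x y

  open Greedy (≡-dec _≟_ _≟_) Conflict Conflict-sym Conflict-irrefl

  _≼_ : Edge → Edge → Set
  e ≼ f = uncurry weight e ≤ uncurry weight f

  weight-sorted⇒degenerate : ∀ {L} → AllPairs _≼_ L → (∀ {e} → e ∈ L → e ∈ edges) → Degenerate 6 L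
  weight-sorted⇒degenerate [] _ = []
  weight-sorted⇒degenerate {(u , v) ∷ rest} (below ∷ pairs) ⊆edges
    with cover (∈-edges⇒Adj (⊆edges (here refl)))
  ... | cov@(C , len , _) = (C , len , covers) ∷ weight-sorted⇒degenerate pairs (⊆edges ∘ there)
    where
    covers : ∀ {f} → f ∈ rest → Conflict (u , v) f → f ∈ C
    covers {x , y} f∈ (_ , x~y , notSame , near) =
      subst (_∈ C) (∈-edges⇒normal (⊆edges (there f∈)))
        (Cover⇒covers-conflicts cov (x~y , notSame , All.lookup below f∈) near)

  order : DecTotalOrder _ _ _
  order = On.decTotalOrder ≤-decTotalOrder (uncurry weight)

  open Sort order using (sort; sort-↭; sort-↗)

  colouring : StrongEdgeColouring G 7
  colouring
    with greedy-colouring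
           (weight-sorted⇒degenerate (Linked⇒AllPairs ≤-trans (sort-↗ edges)) (∈-resp-↭ (sort-↭ edges)))
  ... | f , proper = record
    { col = λ u v _ → f (edge u v)
    ; colSym = λ u v _ _ → cong f (edge-sym u v)
    ; strong = λ u v x y u~v x~y notSame near →
        proper (sorted∋ u~v) (sorted∋ x~y) (Conflict-edge u~v x~y notSame near)
    }
    where
    sorted∋ : ∀ {x y} → Adj G x y → edge x y ∈ sort edges
    sorted∋ x~y = ∈-resp-↭ (↭-sym (sort-↭ edges)) (∈-edges⁺ x~y)

lemma2 : (G : Graph) → Connected G → ClawFree G → Subcubic G →
    ¬ IsoTo G 6 prismAdj → ¬ IsoTo G 4 K4adj → ¬ IsoTo G 12 K4Δadj →
    Σ (Fin (n G)) (λ v → degree G v ≡ 1) →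
    StrongChromaticIndex≤ G 7
-- The prism, K4 and K4^Δ are cubic, so a vertex of degree 1 already rules them out.
lemma2 G connected clawFree subcubic _ _ _ (root , leaf) =
  StrongColouring.colouring G root connected leaf clawFree subcubic
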